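{- Given $Y,Z\in\mathbb{N}^{\mathbb{N}}$, the following are equivalent: (1) $Y=\mathcal{J}(Z)$; (2) for every $n$ there exists a finite string $\sigma_n\subset Z$ with $|\sigma_n|>n$ such that $Y\restriction n=J(\sigma_n)$.
   Context: Finite strings of natural numbers are identified with natural numbers via a fixed computable coding under which $\sigma\subset\tau$ implies $\sigma<\tau$. For a string or real $\sigma$, $\{e\}^\sigma(n)\downarrow$ means the $e$-th Turing machine with oracle $\sigma$ on input $n$ halts within $|\sigma|$ steps ($|\sigma|=\infty$ for reals), and $\{e\}^Z_t(n)\downarrow$ means it halts in fewer than $t$ steps. $X\restriction t$ is the initial segment of length $t$ (for a string of length $<t$, the string itself). The Jump operator $\mathcal{J}:\mathbb{N}^{\mathbb{N}}\to\mathbb{N}^{\mathbb{N}}$: given $Z$, let $t_{ -1}=1$ and $t_n=\max\{t_{n-1}+1,\mu t(\{n\}^Z_t(n)\downarrow)\}$ (taking $t_n=t_{n-1}+1$ if no such $t$ exists); then $\mathcal{J}(Z)(n)=Z\restriction t_n$. The Jump function $J$ on finite strings: given $\sigma$, let $t_{ -1}=1$, $t_n=\max\{t_{n-1}+1,\mu t(\{n\}^{\sigma\restriction t}(n)\downarrow)\}$ (with $t_n=t_{n-1}+1$ if no such $t$), and $J(\sigma)=\langle\sigma\restriction t_0,\dots,\sigma\restriction t_{k-1}\rangle$ where $k$ is least with $t_k>|\sigma|$. -}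

module Defs where

open import Data.Nat using (ℕ; zero; suc; _+_; _*_; _^_; _≤_; _<_; _⊔_)
open import Data.Bool using (Bool; true)
open import Data.List using (List; []; _∷_; length; take; applyUpTo; foldl; lookup)
open import Data.Fin using (Fin; toℕ)
open import Data.Product using (_×_; ∃-syntax)
open import Relation.Nullary using (¬_)
open import Relation.Binary.PropositionalEquality using (_≡_)

-- Coding of finite strings of naturals as naturals.
-- code [] = 0,  code (σ ++ [x]) = 2 ^ (code σ) * (2x+1)   (= 1 + ⟨code σ , x⟩)
-- This is computable, injective, and σ ⊂ τ (proper prefix) implies code σ < code τ.
code : List ℕ → ℕ
code = foldl (λ c x → 2 ^ c * (1 + 2 * x)) 0

Real : Set
Real = ℕ → ℕ

_↾_ : Real → ℕ → List ℕ
Z ↾ t = applyUpTo Z t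

-- For a finite string σ, σ restricted to t is  take t σ  (σ itself if |σ| < t).

-- Abstract step-counting oracle machine model (fixed enumeration of
-- oracle Turing machines):  M e n t τ ≡ true  means the e-th machine,
-- on input n, with (partial) oracle the finite string τ, halts in fewer
-- than t steps (all oracle queries falling inside τ).
OracleMachines : Set
OracleMachines = ℕ → ℕ → ℕ → List ℕ → Bool

-- {e}^Z_t(n)↓ : halts in fewer than t steps with oracle the real Z
-- (such a computation can only consult Z ↾ t).
HaltsReal : OracleMachines → ℕ → Real → ℕ → ℕ → Set
HaltsReal M e Z n t = M e n t (Z ↾ t) ≡ true

-- {e}^σ(n)↓ : halts within |σ| steps with oracle the string σ.
HaltsStr : OracleMachines → ℕ → List ℕ → ℕ → Set
HaltsStr M e σ n = M e n (length σ) σ ≡ true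

IsLeast : (ℕ → Set) → ℕ → Set
IsLeast P m = P m × (∀ k → k < m → ¬ P k)

-- The sequence t_{-1}, t_0, t_1, ... relative to a halting condition
-- H n t  (the condition inside  μt(...)  for index n).
-- TSeq H 0 1      : t_{-1} = 1
-- TSeq H (suc n) t : t_n = t
data TSeq (H : ℕ → ℕ → Set) : ℕ → ℕ → Set where
  start : TSeq H 0 1
  found : ∀ {n p m} → TSeq H n p → IsLeast (H n) m → TSeq H (suc n) (suc p ⊔ m)
  none  : ∀ {n p} → TSeq H n p → (∀ t → ¬ H n t) → TSeq H (suc n) (suc p)

RealCond : OracleMachines → Real → ℕ → ℕ → Set
RealCond M Z n t = HaltsReal M n Z n t

StrCond : OracleMachines → List ℕ → ℕ → ℕ → Set
StrCond M σ n t = HaltsStr M n (take t σ) n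

IsJumpReal : OracleMachines → Real → Real → Set
IsJumpReal M Z Y = ∀ n → ∃[ t ] (TSeq (RealCond M Z) (suc n) t × Y n ≡ code (Z ↾ t))

-- L = J(σ) :  L = ⟨code(σ↾t_0), …, code(σ↾t_{k-1})⟩ where k (= |L|) is
-- least with t_k > |σ|  (i.e. t_i ≤ |σ| for i < k and t_k > |σ|).
IsJumpStr : OracleMachines → List ℕ → List ℕ → Set
IsJumpStr M σ L =
  (∀ (i : Fin (length L)) → ∃[ t ] (TSeq (StrCond M σ) (suc (toℕ i)) t × t ≤ length σ × lookup L i ≡ code (take t σ)))
  × ∃[ t ] (TSeq (StrCond M σ) (suc (length L)) t × length σ < t)

_⊂_ : List ℕ → Real → Set
σ ⊂ Z = σ ≡ Z ↾ length σ

module Submission where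

-- Both Jumps are the sequence t₋₁, t₀, t₁, ... of `TSeq`, computed from a halting
-- condition H.  For σ = Z ↾ L the string condition {n}^{σ↾t}(n)↓ is the real
-- condition {n}^Z_{t ⊓ L}(n)↓: the real condition *capped* at L.  So the proof
-- is a comparison between the sequence of a condition H and that of its cap
-- `Capped H L`, carried out for an arbitrary H:
--   * `restrict`: every value t ≤ L of the H-sequence is also the capped value;
--   * `exceed`  : if t_{j-1} = L then the capped t_j is > L, so J(Z ↾ L) stops
--                 exactly where the real sequence leaves Z ↾ L;
--   * `lift`    : a value taken by the capped sequences for arbitrarily large L
--                 (with the previous real value below L) is the real value.
-- (1 ⇒ 2) takes σ_n = Z ↾ t_{n-1} and uses `restrict` and `exceed`.
-- (2 ⇒ 1) reads off the entries of Y from the strings σ_N; since the coding of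
-- initial segments of Z is injective they do not depend on N, and `lift`
-- shows by induction that they form the real sequence.

open import Defs
open import Data.Nat using (ℕ; zero; suc; _+_; _*_; _^_; _≤_; _<_; _⊔_; _⊓_; z≤n; s≤s; _≤?_; _≤′_; ≤′-refl; ≤′-step)
open import Data.Nat.Properties
open import Data.List using (_∷_; _∷ʳ_; length; take; applyUpTo; lookup)
open import Data.List.Properties using (length-applyUpTo; lookup-applyUpTo; applyUpTo-∷ʳ; foldl-∷ʳ)
open import Data.Fin using (Fin; toℕ; fromℕ<)
open import Data.Fin.Properties using (toℕ<n; toℕ-fromℕ<)
open import Data.Product using (_×_; ∃-syntax; _,_; proj₁; proj₂)
open import Data.Empty using (⊥-elim)
open import Data.Sum using (inj₁; inj₂)
open import Relation.Nullary using (¬_; yes; no)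
open import Relation.Binary using (tri<; tri≈; tri>)
open import Relation.Binary.PropositionalEquality
open import Function using (id; _∘′_; _⇔_; mk⇔)

variable
  H : ℕ → ℕ → Set
  i j j' k L m m' p t t' : ℕ

take-applyUpTo : ∀ {A : Set} (f : ℕ → A) t L → take t (applyUpTo f L) ≡ applyUpTo f (t ⊓ L)
take-applyUpTo f zero    L       = refl
take-applyUpTo f (suc t) zero    = refl
take-applyUpTo f (suc t) (suc L) = cong (f 0 ∷_) (take-applyUpTo (f ∘′ suc) t L)

n<2^n : ∀ n → n < 2 ^ n
n<2^n zero    = s≤s z≤n
n<2^n (suc n) = begin-strict
  suc n          ≡⟨ +-comm 1 n ⟩
  n + 1          <⟨ +-mono-<-≤ (n<2^n n) (m^n>0 2 n) ⟩
  2 ^ n + 2 ^ n  ≡⟨ cong (2 ^ n +_) (sym (+-identityʳ (2 ^ n))) ⟩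
  2 ^ suc n      ∎
  where open ≤-Reasoning

code-↾-suc : ∀ (Z : Real) t → code (Z ↾ t) < code (Z ↾ suc t)
code-↾-suc Z t = begin-strict
  c                    <⟨ n<2^n c ⟩
  2 ^ c                ≤⟨ m≤m*n (2 ^ c) (1 + 2 * Z t) ⟩
  2 ^ c * (1 + 2 * Z t) ≡⟨ foldl-∷ʳ (λ c x → 2 ^ c * (1 + 2 * x)) 0 (Z t) (Z ↾ t) ⟨
  code (Z ↾ t ∷ʳ Z t)   ≡⟨ cong code (applyUpTo-∷ʳ Z t) ⟩
  code (Z ↾ suc t)      ∎
  where
  open ≤-Reasoning
  c = code (Z ↾ t)

code-↾-mono : ∀ (Z : Real) → t < t' → code (Z ↾ t) < code (Z ↾ t')
code-↾-mono {t} {suc t'} Z (s≤s t≤t') with m≤n⇒m<n∨m≡n t≤t'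
... | inj₁ t<t' = <-trans (code-↾-mono Z t<t') (code-↾-suc Z t')
... | inj₂ refl = code-↾-suc Z t

code-↾-injective : ∀ (Z : Real) → code (Z ↾ t) ≡ code (Z ↾ t') → t ≡ t'
code-↾-injective {t} {t'} Z e with <-cmp t t'
... | tri< t<t' _ _ = ⊥-elim (<-irrefl e (code-↾-mono Z t<t'))
... | tri≈ _ t≡t' _ = t≡t'
... | tri> _ _ t>t' = ⊥-elim (<-irrefl (sym e) (code-↾-mono Z t>t'))

least-unique : ∀ {P : ℕ → Set} → IsLeast P m → IsLeast P m' → m ≡ m'
least-unique {m} {m'} (pm , below-m) (pm' , below-m') with <-cmp m m'
... | tri< m<m' _ _ = ⊥-elim (below-m' m m<m' pm)
... | tri≈ _ m≡m' _ = m≡m'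
... | tri> _ _ m>m' = ⊥-elim (below-m m' m>m' pm')

least-cong : ∀ {P Q : ℕ → Set} → (∀ k → k ≤ m → P k ≡ Q k) → IsLeast P m → IsLeast Q m
least-cong {m} P≡Q (pm , below) =
  subst id (P≡Q m ≤-refl) pm ,
  λ k k<m qk → below k k<m (subst id (sym (P≡Q k (<⇒≤ k<m))) qk)

tseq-det : TSeq H j t → TSeq H j t' → t ≡ t'
tseq-det start          start           = refl
tseq-det (found q l)    (found q' l')   = cong₂ (λ p m → suc p ⊔ m) (tseq-det q q') (least-unique l l')
tseq-det (found q l)    (none q' never) = ⊥-elim (never _ (proj₁ l))
tseq-det (none q never) (found q' l)    = ⊥-elim (never _ (proj₁ l))
tseq-det (none q _)     (none q' _)     = cong suc (tseq-det q q')

tseq-step : TSeq H (suc j) t → ∃[ p ] (TSeq H j p × p < t)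
tseq-step (found {p = p} {m} q l) = p , q , m≤m⊔n (suc p) m
tseq-step (none {p = p} q _)      = p , q , ≤-refl

tseq-index< : TSeq H j t → j < t
tseq-index< {j = zero}  start = s≤s z≤n
tseq-index< {j = suc j} s     = let (_ , q , p<t) = tseq-step s in ≤-trans (s≤s (tseq-index< q)) p<t

tseq-mono : TSeq H j t → TSeq H j' t' → j ≤ j' → t ≤ t'
tseq-mono s s' j≤j' = go s s' (≤⇒≤′ j≤j')
  where
  go : TSeq H j t → TSeq H j' t' → j ≤′ j' → t ≤ t'
  go s s' ≤′-refl       = ≤-reflexive (tseq-det s s')
  go s s' (≤′-step j≤′) = let (_ , q , p<t') = tseq-step s' in ≤-trans (go s q j≤′) (<⇒≤ p<t')

tseq-witness-below : TSeq H (suc j) t → H j m → ∃[ m' ] (m' ≤ t × H j m')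
tseq-witness-below (found {p = p} {m'} _ l) _   = m' , m≤n⊔m (suc p) m' , proj₁ l
tseq-witness-below (none _ never)           hjm = ⊥-elim (never _ hjm)

Capped : (ℕ → ℕ → Set) → ℕ → ℕ → ℕ → Set
Capped H L j k = H j (k ⊓ L)

capped-below : ∀ H → k ≤ L → Capped H L j k ≡ H j k
capped-below {j = j} H k≤L = cong (H j) (m≤n⇒m⊓n≡m k≤L)

to-capped : ∀ H → k ≤ L → H j k → Capped H L j k
to-capped H k≤L = subst id (sym (capped-below H k≤L))

from-capped : ∀ H → k ≤ L → Capped H L j k → H j k
from-capped H k≤L = subst id (capped-below H k≤L)

restrict : TSeq H j t → t ≤ L → TSeq (Capped H L) j t
restrict start _ = start
restrict {H} (found {p = p} {m} q l) t≤L =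
  found (restrict q (<⇒≤ (≤-trans (m≤m⊔n (suc p) m) t≤L)))
        (least-cong (λ k k≤m → sym (capped-below H (≤-trans k≤m (≤-trans (m≤n⊔m (suc p) m) t≤L)))) l)
restrict {L = L} (none q never) t≤L = none (restrict q (<⇒≤ t≤L)) (λ k → never (k ⊓ L))

exceed : TSeq H j L → TSeq H (suc j) t → ∃[ t' ] (TSeq (Capped H L) (suc j) t' × L < t')
exceed {H} {L = L} sL (found {m = m} _ l) with m ≤? L
... | yes m≤L = suc L ⊔ m ,
      found (restrict sL ≤-refl) (least-cong (λ k k≤m → sym (capped-below H (≤-trans k≤m m≤L))) l) ,
      m≤m⊔n (suc L) m
... | no m≰L = suc L ,
      none (restrict sL ≤-refl) (λ k → proj₂ l (k ⊓ L) (≤-<-trans (m⊓n≤n k L) (≰⇒> m≰L))) ,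
      ≤-refl
exceed {L = L} sL (none _ never) = suc L , none (restrict sL ≤-refl) (λ k → never (k ⊓ L)) , ≤-refl

lift : TSeq H i p → (∀ m → ∃[ L ] (m ≤ L × p ≤ L × t ≤ L × TSeq (Capped H L) (suc i) t)) →
       TSeq H (suc i) t
lift {H} {i} hp large with large 0
... | L₀ , _ , p≤L₀ , t≤L₀ , found {p = p'} {m} q l =
  found (subst (TSeq H i) (tseq-det (restrict hp p≤L₀) q) hp)
        (least-cong (λ k k≤m → capped-below H (≤-trans k≤m (≤-trans (m≤n⊔m (suc p') m) t≤L₀))) l)
... | L₀ , _ , p≤L₀ , t≤L₀ , none q never =
  none (subst (TSeq H i) (tseq-det (restrict hp p≤L₀) q) hp) never-real
  where
  -- A witness m would show up below t in the sequence capped at some L ≥ m,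
  -- hence below L₀, where there is none.
  never-real : ∀ m → ¬ H i m
  never-real m him with large m
  ... | L , m≤L , _ , t≤L , s with tseq-witness-below s (to-capped H m≤L him)
  ...   | m' , m'≤t , hm' = never m' (to-capped H (≤-trans m'≤t t≤L₀) (from-capped H (≤-trans m'≤t t≤L) hm'))

str-capped : ∀ M (Z : Real) → StrCond M (Z ↾ L) j k ≡ Capped (RealCond M Z) L j k
str-capped {L} {j} {k} M Z rewrite take-applyUpTo Z k L | length-applyUpTo Z (k ⊓ L) = refl

take-↾ : ∀ (Z : Real) → t ≤ L → take t (Z ↾ L) ≡ Z ↾ t
take-↾ {t} {L} Z t≤L = trans (take-applyUpTo Z t L) (cong (Z ↾_) (m≤n⇒m⊓n≡m t≤L))

tseq-cong : ∀ {H' : ℕ → ℕ → Set} → (∀ j k → H j k ≡ H' j k) → TSeq H j t → TSeq H' j t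
tseq-cong H≡H' start       = start
tseq-cong H≡H' (found q l) = found (tseq-cong H≡H' q) (least-cong (λ k _ → H≡H' _ k) l)
tseq-cong H≡H' (none q never) =
  none (tseq-cong H≡H' q) (λ k h → never k (subst id (sym (H≡H' _ k)) h))

CappedValue : OracleMachines → Real → ℕ → ℕ → ℕ → Set
CappedValue M Z L i t = t ≤ L × TSeq (Capped (RealCond M Z) L) (suc i) t

jumpStr-intro : ∀ M (Y Z : Real) N →
  (∀ i → i < N → ∃[ t ] (CappedValue M Z L i t × Y i ≡ code (Z ↾ t))) →
  ∃[ t ] (TSeq (Capped (RealCond M Z) L) (suc N) t × L < t) →
  IsJumpStr M (Z ↾ L) (Y ↾ N)
jumpStr-intro {L} M Y Z N entries (t , s , L<t) = entry , overflow
  where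
  entry : ∀ (i : Fin (length (Y ↾ N))) →
    ∃[ t ] (TSeq (StrCond M (Z ↾ L)) (suc (toℕ i)) t × t ≤ length (Z ↾ L) × lookup (Y ↾ N) i ≡ code (take t (Z ↾ L)))
  entry i with entries (toℕ i) (subst (toℕ i <_) (length-applyUpTo Y N) (toℕ<n i))
  ... | t , (t≤L , s) , Yi≡ =
    t , tseq-cong (λ _ _ → sym (str-capped M Z)) s ,
    subst (t ≤_) (sym (length-applyUpTo Z L)) t≤L ,
    trans (lookup-applyUpTo Y N i) (trans Yi≡ (cong code (sym (take-↾ Z t≤L))))
  overflow : ∃[ t ] (TSeq (StrCond M (Z ↾ L)) (suc (length (Y ↾ N))) t × length (Z ↾ L) < t)
  overflow rewrite length-applyUpTo Y N | length-applyUpTo Z L =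
    t , tseq-cong (λ _ _ → sym (str-capped M Z)) s , L<t

jumpStr-lookup : ∀ M (Y Z : Real) N → IsJumpStr M (Z ↾ L) (Y ↾ N) →
  ∀ (i : Fin (length (Y ↾ N))) → ∃[ t ] (CappedValue M Z L (toℕ i) t × Y (toℕ i) ≡ code (Z ↾ t))
jumpStr-lookup {L} M Y Z N (entry , _) i with entry i
... | t , s , t≤|σ| , lookup≡ =
  t , (t≤L , tseq-cong (λ _ _ → str-capped M Z) s) ,
  trans (sym (lookup-applyUpTo Y N i)) (trans lookup≡ (cong code (take-↾ Z t≤L)))
  where
  t≤L : t ≤ L
  t≤L = subst (t ≤_) (length-applyUpTo Z L) t≤|σ|

jumpStr-entry : ∀ M (Y Z : Real) N → IsJumpStr M (Z ↾ L) (Y ↾ N) →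
  ∀ i → i < N → ∃[ t ] (CappedValue M Z L i t × Y i ≡ code (Z ↾ t))
jumpStr-entry {L} M Y Z N jumpσ i i<N =
  subst (λ k → ∃[ t ] (CappedValue M Z L k t × Y k ≡ code (Z ↾ t)))
        (toℕ-fromℕ< i<length) (jumpStr-lookup M Y Z N jumpσ (fromℕ< i<length))
  where
  i<length : i < length (Y ↾ N)
  i<length = subst (i <_) (sym (length-applyUpTo Y N)) i<N

-- (1 ⇒ 2): σ_n = Z ↾ t_{n-1}.
module JumpToPrefixes (M : OracleMachines) (Y Z : Real) (jump : IsJumpReal M Z Y) where

  -- The sequence of 𝒥(Z): T n = t_{n-1}.
  T : ℕ → ℕ
  T zero    = 1
  T (suc n) = proj₁ (jump n)

  T-seq : ∀ n → TSeq (RealCond M Z) n (T n)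
  T-seq zero    = start
  T-seq (suc n) = proj₁ (proj₂ (jump n))

  -- Z ↾ t_{n-1} has length t_{n-1} > n; its Jump lists t_0, ..., t_{n-1}
  -- unchanged (`restrict`) and then stops (`exceed`).
  prefixes : ∀ n → ∃[ σ ] (σ ⊂ Z × n < length σ × IsJumpStr M σ (Y ↾ n))
  prefixes n =
    Z ↾ T n ,
    cong (Z ↾_) (sym (length-applyUpTo Z (T n))) ,
    subst (n <_) (sym (length-applyUpTo Z (T n))) (tseq-index< (T-seq n)) ,
    jumpStr-intro M Y Z n entries (exceed (T-seq n) (T-seq (suc n)))
    where
    entries : ∀ i → i < n → ∃[ t ] (CappedValue M Z (T n) i t × Y i ≡ code (Z ↾ t))
    entries i i<n = T (suc i) , (ti≤Tn , restrict (T-seq (suc i)) ti≤Tn) , proj₂ (proj₂ (jump i))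
      where
      ti≤Tn : T (suc i) ≤ T n
      ti≤Tn = tseq-mono (T-seq (suc i)) (T-seq n) i<n

module PrefixesToJump (M : OracleMachines) (Y Z : Real)
    (prefixes : ∀ n → ∃[ σ ] (σ ⊂ Z × n < length σ × IsJumpStr M σ (Y ↾ n))) where

  ℓ : ℕ → ℕ
  ℓ N = length (proj₁ (prefixes N))

  N<ℓ : ∀ N → N < ℓ N
  N<ℓ N = proj₁ (proj₂ (proj₂ (prefixes N)))

  σ-jump : ∀ N → IsJumpStr M (Z ↾ ℓ N) (Y ↾ N)
  σ-jump N with prefixes N
  ... | σ , σ⊂Z , _ , jumpσ = subst (λ σ → IsJumpStr M σ (Y ↾ N)) σ⊂Z jumpσ

  τ : ℕ → ℕ
  τ i = proj₁ (jumpStr-entry M Y Z (suc i) (σ-jump (suc i)) i ≤-refl)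

  Y≡code-τ : ∀ i → Y i ≡ code (Z ↾ τ i)
  Y≡code-τ i = proj₂ (proj₂ (jumpStr-entry M Y Z (suc i) (σ-jump (suc i)) i ≤-refl))

  -- Since codes of initial segments are injective, every σ_N with N > i sees τ i.
  τ-capped : ∀ N i → i < N → CappedValue M Z (ℓ N) i (τ i)
  τ-capped N i i<N with jumpStr-entry M Y Z N (σ-jump N) i i<N
  ... | t , value , Yi≡ = subst (CappedValue M Z (ℓ N) i) (code-↾-injective Z (trans (sym Yi≡) (Y≡code-τ i))) value

  -- prev j = t_{j-1}.
  prev : ℕ → ℕ
  prev zero    = 1
  prev (suc i) = τ i

  prev≤ℓ : ∀ j N → j ≤ N → prev j ≤ ℓ N
  prev≤ℓ zero    N _   = ≤-trans (s≤s z≤n) (N<ℓ N)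
  prev≤ℓ (suc i) N i<N = proj₁ (τ-capped N i i<N)

  real-seq : ∀ j → TSeq (RealCond M Z) j (prev j)
  real-seq zero    = start
  real-seq (suc i) = lift (real-seq i) large-caps
    where
    large-caps : ∀ m → ∃[ L ] (m ≤ L × prev i ≤ L × τ i ≤ L × TSeq (Capped (RealCond M Z) L) (suc i) (τ i))
    large-caps m =
      ℓ N , ≤-trans (m≤n⊔m (suc i) m) (<⇒≤ (N<ℓ N)) , prev≤ℓ i N (≤-trans (n≤1+n i) i<N) , τ-capped N i i<N
      where
      N : ℕ
      N = suc i ⊔ m
      i<N : i < N
      i<N = m≤m⊔n (suc i) m

  jump : IsJumpReal M Z Y
  jump n = τ n , real-seq (suc n) , Y≡code-τ n

lemma4p5 : (M : OracleMachines) (Y Z : Real) →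
    IsJumpReal M Z Y ⇔ (∀ n → ∃[ σ ] (σ ⊂ Z × n < length σ × IsJumpStr M σ (Y ↾ n)))
lemma4p5 M Y Z = mk⇔ (JumpToPrefixes.prefixes M Y Z) (PrefixesToJump.jump M Y Z)
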